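{- For $s\in\mathbb{N}$, let $\mathcal{F}_s$ be the set of binary cubic forms $f=(a,b,c,d)$ over $\mathbb{F}_q[t]$ such that $\deg(D(f))=s$, $\deg(a)\le s/4$, $\deg(b)\le s/4$, $\deg(ad)\le s/2$, $\deg(bc)\le s/2$, and $\mathrm{sgn}(a)\in S$. Then, as $s\to\infty$, $$\#\mathcal{F}_s\le\begin{cases}\dfrac{q^3}{32}\,s^2q^s+O(sq^s)&\text{if } s \text{ is odd},\\[6pt] \dfrac{q^4}{32}\,s^2q^s+O(sq^s)&\text{if } s \text{ is even}.\end{cases}$$
   Context: Let $q$ be a power of a prime $p\ge5$. For nonzero $H\in\mathbb{F}_q[t]$, $\mathrm{sgn}(H)$ denotes its leading coefficient. Fix a primitive root $h$ of $\mathbb{F}_q^*$ and $S=\{h^i:0\le i\le(q-3)/2\}$. A binary cubic form $(a,b,c,d)$ is $ax^3+bx^2y+cxy^2+dy^3$ with coefficients in $\mathbb{F}_q[t]$; its discriminant is $D(f)=18abcd+b^2c^2-4ac^3-4b^3d-27a^2d^2$. Binary cubic forms are assumed primitive, irreducible over $\mathbb{F}_q[t]$ (in particular $ad\neq0$), with nonzero discriminant. -}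

module Defs where

open import Data.Nat using (ℕ; zero; suc; _≤_) renaming (_+_ to _+ℕ_; _*_ to _*ℕ_; _∸_ to _∸ℕ_)
open import Data.List using (List; []; _∷_; length; map; last)
open import Data.List.Membership.Propositional using (_∈_)
open import Data.List.Relation.Unary.Unique.Propositional using (Unique)
open import Data.Maybe using (just)
open import Data.Product using (Σ; ∃; _×_; _,_)
open import Data.Sum using (_⊎_)
open import Relation.Binary.PropositionalEquality using (_≡_; _≢_)
open import Relation.Binary.Definitions using (DecidableEquality)
open import Relation.Nullary using (¬_; yes; no)
import Algebra.Structures as AS

-- A finite field F_q, with propositional equality as its equality.
-- q := card = number of elements (length of a duplicate-free complete list).

record FiniteField : Set₁ where
  field
    F            : Set
    _≟_          : DecidableEquality F
    0# 1#        : F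
    _+_ _*_      : F → F → F
    -_           : F → F
    isCommRing   : AS.IsCommutativeRing (_≡_ {A = F}) _+_ _*_ -_ 0# 1#
    0≢1          : 0# ≢ 1#
    inverse      : ∀ x → x ≢ 0# → Σ F (λ y → x * y ≡ 1#)
    elems        : List F
    elems-complete : ∀ x → x ∈ elems
    elems-unique   : Unique elems

  card : ℕ
  card = length elems

module FieldOps (K : FiniteField) where
  open FiniteField K

  pow : F → ℕ → F
  pow x zero    = 1#
  pow x (suc n) = x * pow x n

  natF : ℕ → F
  natF zero    = 0#
  natF (suc n) = 1# + natF n

  -- Polynomials in F_q[t]: coefficient lists, lowest degree first.
  Poly : Set
  Poly = List F

  addP : Poly → Poly → Poly
  addP []       q        = q
  addP (x ∷ p)  []       = x ∷ p
  addP (x ∷ p)  (y ∷ q)  = (x + y) ∷ addP p q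

  scaleP : F → Poly → Poly
  scaleP c p = map (c *_) p

  negP : Poly → Poly
  negP p = map -_ p

  subP : Poly → Poly → Poly
  subP p q = addP p (negP q)

  mulP : Poly → Poly → Poly
  mulP []      q = []
  mulP (x ∷ p) q = addP (scaleP x q) (0# ∷ mulP p q)

  strip : Poly → Poly
  strip [] = []
  strip (x ∷ p) with strip p
  ... | y ∷ r = x ∷ y ∷ r
  ... | [] with x ≟ 0#
  ...   | yes _ = []
  ...   | no  _ = x ∷ []

  Normalized : Poly → Set
  Normalized p = strip p ≡ p

  _≈P_ : Poly → Poly → Set
  p ≈P q = strip p ≡ strip q

  deg : Poly → ℕ
  deg p = length (strip p) ∸ℕ 1

  -- "deg(p) ≤ m / k" with the convention deg(0) = -∞
  DegLe : ℕ → Poly → ℕ → Set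
  DegLe k p m = strip p ≡ [] ⊎ k *ℕ deg p ≤ m

  _∣P_ : Poly → Poly → Set
  g ∣P p = Σ Poly (λ r → mulP g r ≈P p)

  -- Binary cubic forms a x^3 + b x^2 y + c x y^2 + d y^3
  record Form : Set where
    constructor form
    field a b c d : Poly

  disc : Form → Poly
  disc (form a b c d) =
    subP (subP (subP (addP (scaleP (natF 18) (mulP (mulP a b) (mulP c d)))
                           (mulP (mulP b b) (mulP c c)))
                     (scaleP (natF 4) (mulP a (mulP c (mulP c c)))))
               (scaleP (natF 4) (mulP (mulP b (mulP b b)) d)))
         (scaleP (natF 27) (mulP (mulP a a) (mulP d d)))

  -- primitive: every common divisor of a,b,c,d is a nonzero constant
  Primitive : Form → Set
  Primitive (form a b c d) =
    ∀ g → Normalized g → g ∣P a → g ∣P b → g ∣P c → g ∣P d → length g ≡ 1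

  Irreducible : Form → Set
  Irreducible (form a b c d) =
    ¬ (Σ Poly λ r → Σ Poly λ s → Σ Poly λ u → Σ Poly λ v → Σ Poly λ w →
         (a ≈P mulP r u) × (b ≈P addP (mulP r v) (mulP s u)) ×
         (c ≈P addP (mulP r w) (mulP s v)) × (d ≈P mulP s w))

  PrimitiveRoot : F → Set
  PrimitiveRoot h = h ≢ 0# × (∀ x → x ≢ 0# → Σ ℕ λ i → pow h i ≡ x)

  -- sgn(p) ∈ S = { h^i : 0 ≤ i ≤ (q-3)/2 }
  SgnInS : F → Poly → Set
  SgnInS h p = Σ ℕ λ i → (2 *ℕ i ≤ card ∸ℕ 3) × (last (strip p) ≡ just (pow h i))

  InFs : F → ℕ → Form → Set
  InFs h s f@(form a b c d) =
    Normalized a × Normalized b × Normalized c × Normalized d ×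
    a ≢ [] × d ≢ [] ×
    Primitive f × Irreducible f ×
    strip (disc f) ≢ [] × deg (disc f) ≡ s ×
    DegLe 4 a s × DegLe 4 b s ×
    DegLe 2 (mulP a d) s × DegLe 2 (mulP b c) s ×
    SgnInS h a

-- A form in 𝓕_s is determined by the pairs (a, d) and (b, c).  Fixing i = deg a ≤ s/4, a has at most q/2
-- leading coefficients (those in S) and q^i lower ones, and deg d ≤ s/2 - i leaves q^(s/2 - i + 1) choices
-- for d, so there are at most (s/4 + 1)(q/2)q^(⌊s/2⌋+1) pairs (a, d); in the same way there are at most
-- (s/4 + 1)q^(⌊s/2⌋+2) pairs (b, c) with b ≠ 0.  If b = 0 the discriminant is -4ac³ - 27a²d², and as
-- deg(a²d²) ≤ s the term 4ac³ has degree at most s, so deg c ≤ s/3 and these forms are of lower order.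
-- Hence 32 #𝓕_s ≤ (s + 4)² q^(2⌊s/2⌋+4) + O(s q^s).  Only the degree conditions and sgn(a) ∈ S are used;
-- 4 ≠ 0 in F_q because q is odd, as 1 + 1 = 0 would make x ↦ x + 1 a fixed-point-free involution of F_q.

module Submission where

open import Defs
open import Data.Nat
  using (ℕ; zero; suc; _≤_; _<_; _^_; _/_; _%_; z≤n; s≤s; z<s; NonZero; >-nonZero)
  renaming (_+_ to _+ℕ_; _*_ to _*ℕ_; _∸_ to _∸ℕ_)
import Data.Nat.Properties as ℕ
open import Data.Nat.DivMod using (m≡m%n+[m/n]*n; m%n<n; m/n*n≤m; m*n/n≡m; /-monoˡ-≤; /-monoʳ-≤)
open import Data.Nat.Divisibility using (_∣_; ∣m∣n⇒∣m+n; ∣-refl; divides-refl; ∣1⇒≡1)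
open import Data.Nat.Primality using (Prime; prime[2]; euclidsLemma; prime⇒irreducible)
open import Data.Nat.Tactic.RingSolver using (solve-∀)
open import Data.Fin using (Fin)
import Data.Fin as Fin
open import Data.Fin.Properties using (injective⇒≤)
open import Data.List
  using (List; []; _∷_; [_]; length; lookup; filter; map; _++_; _∷ʳ_; last; concatMap;
         cartesianProduct; cartesianProductWith; upTo; replicate; initLast; _∷ʳ′_)
open import Data.List.Properties
  using (length-++; length-replicate; length-map; length-upTo; filter-all; filter-accept; filter-reject)
open import Data.List.Membership.Propositional using (_∈_; lose)
open import Data.List.Membership.Propositional.Properties
  using (∈-lookup; ∈-filter⁺; ∈-filter⁻; ∈-map⁺; ∈-++⁺ˡ; ∈-++⁺ʳ; ∈-concatMap⁺; ∈-cartesianProductWith⁺;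
         ∈-upTo⁺; ∈-upTo⁻)
open import Data.List.Membership.Setoid.Properties using (index-injective)
open import Data.List.Relation.Binary.Subset.Propositional using (_⊆_)
open import Data.List.Relation.Unary.All as All using (All; []; _∷_)
open import Data.List.Relation.Unary.All.Properties using (All¬⇒¬Any)
open import Data.List.Relation.Unary.Any using (here; there; index)
open import Data.List.Relation.Unary.Unique.Propositional using (Unique; []; _∷_)
import Data.List.Relation.Unary.Unique.Propositional.Properties as Unique
open import Data.Maybe using (just)
open import Data.Maybe.Properties using (just-injective)
open import Data.Product using (Σ; _×_; _,_)
open import Data.Sum using (inj₁; inj₂)
open import Relation.Binary.Definitions using (DecidableEquality)
open import Relation.Binary.PropositionalEquality
  using (_≡_; _≢_; refl; sym; trans; cong; cong₂; subst; setoid; module ≡-Reasoning)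
open import Relation.Nullary using (¬_; ¬?; yes; no; contradiction)
open import Function using (_∘_)
open import Algebra.Bundles using (CommutativeRing)
import Algebra.Properties.Ring as RingProperties

module _ {A : Set} where

  lookup-injective : ∀ {xs : List A} → Unique xs → ∀ i j → lookup xs i ≡ lookup xs j → i ≡ j
  lookup-injective (_ ∷ _)  Fin.zero    Fin.zero    _ = refl
  lookup-injective (x∉ ∷ _) Fin.zero    (Fin.suc j) e = contradiction e (All.lookup x∉ (∈-lookup j))
  lookup-injective (x∉ ∷ _) (Fin.suc i) Fin.zero    e = contradiction (sym e) (All.lookup x∉ (∈-lookup i))
  lookup-injective (_ ∷ u)  (Fin.suc i) (Fin.suc j) e = cong Fin.suc (lookup-injective u i j e)

  unique-⊆⇒length≤ : ∀ {xs ys : List A} → Unique xs → xs ⊆ ys → length xs ≤ length ys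
  unique-⊆⇒length≤ {xs} u xs⊆ys = injective⇒≤ {f = position} position-injective
    where
    position : Fin (length xs) → Fin _
    position i = index (xs⊆ys (∈-lookup i))
    position-injective : ∀ {i j} → position i ≡ position j → i ≡ j
    position-injective {i} {j} e = lookup-injective u i j (index-injective (setoid A) _ _ e)

  length-cartesianProductWith : ∀ {B C : Set} (f : A → B → C) xs ys →
                                length (cartesianProductWith f xs ys) ≡ length xs *ℕ length ys
  length-cartesianProductWith f []       ys = refl
  length-cartesianProductWith f (x ∷ xs) ys = begin
    length (map (f x) ys ++ cartesianProductWith f xs ys)
      ≡⟨ length-++ (map (f x) ys) ⟩
    length (map (f x) ys) +ℕ length (cartesianProductWith f xs ys)
      ≡⟨ cong₂ _+ℕ_ (length-map (f x) ys) (length-cartesianProductWith f xs ys) ⟩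
    length ys +ℕ length xs *ℕ length ys ∎
    where open ≡-Reasoning

  length-concatMap-const : ∀ {B : Set} (f : A → List B) xs k → (∀ {x} → x ∈ xs → length (f x) ≡ k) →
                           length (concatMap f xs) ≡ length xs *ℕ k
  length-concatMap-const f []       k _     = refl
  length-concatMap-const f (x ∷ xs) k const =
    trans (length-++ (f x)) (cong₂ _+ℕ_ (const (here refl)) (length-concatMap-const f xs k (const ∘ there)))

  last-∷ʳ : ∀ (xs : List A) x → last (xs ∷ʳ x) ≡ just x
  last-∷ʳ []           x = refl
  last-∷ʳ (_ ∷ [])     x = refl
  last-∷ʳ (_ ∷ y ∷ ys) x = last-∷ʳ (y ∷ ys) x

  ∈-concatMap⁺′ : ∀ {B : Set} (f : A → List B) {xs x y} → x ∈ xs → y ∈ f x → y ∈ concatMap f xs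
  ∈-concatMap⁺′ f x∈xs y∈fx = ∈-concatMap⁺ f (lose x∈xs y∈fx)

module _ {A : Set} (_≟_ : DecidableEquality A) where

  private
    remove : A → List A → List A
    remove y = filter (λ z → ¬? (z ≟ y))

    length-remove : ∀ {y} {xs : List A} → Unique xs → y ∈ xs → length xs ≡ suc (length (remove y xs))
    length-remove {y} {_ ∷ xs} (y∉ ∷ _) (here refl) = cong suc (sym (begin
      length (remove y (y ∷ xs)) ≡⟨ cong length (filter-reject (λ z → ¬? (z ≟ y)) (λ y≢y → y≢y refl)) ⟩
      length (remove y xs)       ≡⟨ cong length (filter-all _ (All.map (λ y≢z z≡y → y≢z (sym z≡y)) y∉)) ⟩
      length xs                  ∎))
      where open ≡-Reasoning
    length-remove {y} {x ∷ xs} (x∉ ∷ u) (there y∈) = begin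
      suc (length xs)                   ≡⟨ cong suc (length-remove u y∈) ⟩
      suc (suc (length (remove y xs)))  ≡⟨ cong (suc ∘ length) (filter-accept (λ z → ¬? (z ≟ y)) (All.lookup x∉ y∈)) ⟨
      suc (length (remove y (x ∷ xs)))  ∎
      where open ≡-Reasoning

  involution⇒2∣length : (f : A → A) → (∀ x → f (f x) ≡ x) → (∀ x → f x ≢ x) →
                        ∀ {xs} → Unique xs → (∀ {x} → x ∈ xs → f x ∈ xs) → 2 ∣ length xs
  involution⇒2∣length f involutive no-fixpoint {xs} u closed = go (length xs) xs refl u closed
    where
    go : ∀ n xs → length xs ≡ n → Unique xs → (∀ {x} → x ∈ xs → f x ∈ xs) → 2 ∣ n
    go zero          _        _ _ _ = divides-refl 0
    go (suc zero)    (x ∷ []) _ _ closed with closed (here refl)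
    ... | here fx≡x = contradiction fx≡x (no-fixpoint x)
    go (suc (suc n)) (x ∷ xs) e (x∉ ∷ u) closed =
      ∣m∣n⇒∣m+n ∣-refl (go n rest length-rest (Unique.filter⁺ _ u) rest-closed)
      where
      rest = remove (f x) xs
      fx∈xs : f x ∈ xs
      fx∈xs with closed (here refl)
      ... | here fx≡x = contradiction fx≡x (no-fixpoint x)
      ... | there fx∈ = fx∈
      length-rest : length rest ≡ n
      length-rest = ℕ.suc-injective (trans (sym (length-remove u fx∈xs)) (ℕ.suc-injective e))
      rest-closed : ∀ {z} → z ∈ rest → f z ∈ rest
      rest-closed z∈ with ∈-filter⁻ _ z∈
      ... | z∈xs , z≢fx with closed (there z∈xs)
      ...   | here fz≡x = contradiction (trans (sym (involutive _)) (cong f fz≡x)) z≢fx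
      ...   | there fz∈ = ∈-filter⁺ _ fz∈ λ fz≡fx →
                All¬⇒¬Any x∉ (subst (_∈ xs) (trans (sym (involutive _)) (trans (cong f fz≡fx) (involutive x))) z∈xs)

prime≢2⇒¬2∣prime^ : ∀ {p} → Prime p → p ≢ 2 → ∀ k → ¬ 2 ∣ p ^ k
prime≢2⇒¬2∣prime^ pp p≢2 zero    2∣1 = contradiction (∣1⇒≡1 2∣1) λ ()
prime≢2⇒¬2∣prime^ {p} pp p≢2 (suc k) 2∣p^k+1 with euclidsLemma p (p ^ k) prime[2] 2∣p^k+1
... | inj₂ 2∣p^k = prime≢2⇒¬2∣prime^ pp p≢2 k 2∣p^k
... | inj₁ 2∣p with prime⇒irreducible pp 2∣p
...   | inj₁ ()
...   | inj₂ 2≡p = p≢2 (sym 2≡p)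

*≤⇒≤/ : ∀ k x s .{{_ : NonZero k}} → k *ℕ x ≤ s → x ≤ s / k
*≤⇒≤/ k x s kx≤s = subst (_≤ s / k) (m*n/n≡m x k) (/-monoˡ-≤ k (subst (_≤ s) (ℕ.*-comm k x) kx≤s))

2*suc[[q∸3]/2]≤q : ∀ {q} → 2 ≤ q → 2 *ℕ suc ((q ∸ℕ 3) / 2) ≤ q
2*suc[[q∸3]/2]≤q {q} 2≤q = begin
  2 *ℕ suc ((q ∸ℕ 3) / 2)      ≡⟨ ℕ.*-suc 2 ((q ∸ℕ 3) / 2) ⟩
  2 +ℕ 2 *ℕ ((q ∸ℕ 3) / 2)     ≤⟨ ℕ.+-monoʳ-≤ 2 (subst (_≤ q ∸ℕ 3) (ℕ.*-comm ((q ∸ℕ 3) / 2) 2) (m/n*n≤m (q ∸ℕ 3) 2)) ⟩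
  2 +ℕ (q ∸ℕ 3)                ≤⟨ ℕ.+-monoʳ-≤ 2 (ℕ.∸-monoʳ-≤ q (ℕ.n≤1+n 2)) ⟩
  2 +ℕ (q ∸ℕ 2)                ≡⟨ ℕ.m+[n∸m]≡n 2≤q ⟩
  q                            ∎
  where open ℕ.≤-Reasoning

-- 2⌊s/2⌋ + 4 is s + 3 or s + 4 according to the parity of s: the source of the two cases of the theorem.
dominant-exponent : ∀ s → 2 +ℕ (suc (s / 2) +ℕ suc (s / 2)) ≡ (4 ∸ℕ s % 2) +ℕ s
dominant-exponent s = begin
  2 +ℕ (suc (s / 2) +ℕ suc (s / 2))   ≡⟨ regroup (s / 2) ⟩
  4 +ℕ s / 2 *ℕ 2                     ≡⟨ cong (_+ℕ s / 2 *ℕ 2) (ℕ.m∸n+n≡m s%2≤4) ⟨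
  (4 ∸ℕ s % 2) +ℕ s % 2 +ℕ s / 2 *ℕ 2 ≡⟨ ℕ.+-assoc (4 ∸ℕ s % 2) (s % 2) _ ⟩
  (4 ∸ℕ s % 2) +ℕ (s % 2 +ℕ s / 2 *ℕ 2) ≡⟨ cong ((4 ∸ℕ s % 2) +ℕ_) (m≡m%n+[m/n]*n s 2) ⟨
  (4 ∸ℕ s % 2) +ℕ s                   ∎
  where
  open ≡-Reasoning
  regroup : ∀ m → 2 +ℕ (suc m +ℕ suc m) ≡ 4 +ℕ m *ℕ 2
  regroup = solve-∀
  s%2≤4 : s % 2 ≤ 4
  s%2≤4 = ℕ.≤-trans (ℕ.<⇒≤ (m%n<n s 2)) (ℕ.m≤m+n 2 2)

b≡0-exponent : ∀ s → suc (suc (s / 2) +ℕ suc (s / 3)) ≤ 4 +ℕ s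
b≡0-exponent s = begin
  suc (suc (s / 2) +ℕ suc (s / 3))  ≡⟨ cong (2 +ℕ_) (ℕ.+-suc (s / 2) (s / 3)) ⟩
  3 +ℕ (s / 2 +ℕ s / 3)             ≤⟨ ℕ.+-monoʳ-≤ 3 (ℕ.+-monoʳ-≤ (s / 2) (/-monoʳ-≤ s {3} {2} (s≤s (s≤s z≤n)))) ⟩
  3 +ℕ (s / 2 +ℕ s / 2)             ≤⟨ ℕ.+-monoʳ-≤ 3 (subst (_≤ s) (double (s / 2)) (m/n*n≤m s 2)) ⟩
  3 +ℕ s                            ≤⟨ ℕ.n≤1+n _ ⟩
  4 +ℕ s                            ∎
  where
  open ℕ.≤-Reasoning
  double : ∀ m → m *ℕ 2 ≡ m +ℕ m
  double = solve-∀

dominant-power : ∀ q s → q *ℕ (q *ℕ (q ^ suc (s / 2) *ℕ q ^ suc (s / 2))) ≡ q ^ (4 ∸ℕ s % 2) *ℕ q ^ s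
dominant-power q s = begin
  q *ℕ (q *ℕ (q ^ suc (s / 2) *ℕ q ^ suc (s / 2)))
    ≡⟨ cong (λ z → q *ℕ (q *ℕ z)) (ℕ.^-distribˡ-+-* q (suc (s / 2)) (suc (s / 2))) ⟨
  q ^ (2 +ℕ (suc (s / 2) +ℕ suc (s / 2)))           ≡⟨ cong (q ^_) (dominant-exponent s) ⟩
  q ^ ((4 ∸ℕ s % 2) +ℕ s)                           ≡⟨ ℕ.^-distribˡ-+-* q (4 ∸ℕ s % 2) s ⟩
  q ^ (4 ∸ℕ s % 2) *ℕ q ^ s                         ∎
  where open ≡-Reasoning

b≡0-power : ∀ q s .{{_ : NonZero q}} → q *ℕ (q ^ suc (s / 2) *ℕ q ^ suc (s / 3)) ≤ q ^ 4 *ℕ q ^ s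
b≡0-power q s = begin
  q *ℕ (q ^ suc (s / 2) *ℕ q ^ suc (s / 3))  ≡⟨ cong (q *ℕ_) (ℕ.^-distribˡ-+-* q (suc (s / 2)) (suc (s / 3))) ⟨
  q ^ suc (suc (s / 2) +ℕ suc (s / 3))       ≤⟨ ℕ.^-monoʳ-≤ q (b≡0-exponent s) ⟩
  q ^ (4 +ℕ s)                               ≡⟨ ℕ.^-distribˡ-+-* q 4 s ⟩
  q ^ 4 *ℕ q ^ s                             ∎
  where open ℕ.≤-Reasoning

4*suc≤4+ : ∀ {a s} → 4 *ℕ a ≤ s → 4 *ℕ suc a ≤ 4 +ℕ s
4*suc≤4+ {a} {s} 4a≤s = subst (_≤ 4 +ℕ s) (sym (ℕ.*-suc 4 a)) (ℕ.+-monoʳ-≤ 4 4a≤s)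

dominant-term-bound : ∀ {q m s A} E → 2 *ℕ m ≤ q → 4 *ℕ A ≤ s →
  32 *ℕ ((suc A *ℕ (m *ℕ E)) *ℕ (suc A *ℕ (q *ℕ E))) ≤ (4 +ℕ s) *ℕ (4 +ℕ s) *ℕ (q *ℕ (q *ℕ (E *ℕ E)))
dominant-term-bound {q} {m} {s} {A} E 2m≤q 4A≤s = begin
  32 *ℕ ((suc A *ℕ (m *ℕ E)) *ℕ (suc A *ℕ (q *ℕ E)))      ≡⟨ regroup A m q E ⟩
  (4 *ℕ suc A) *ℕ (4 *ℕ suc A) *ℕ (2 *ℕ m *ℕ (q *ℕ (E *ℕ E)))
    ≤⟨ ℕ.*-mono-≤ (ℕ.*-mono-≤ (4*suc≤4+ {A} 4A≤s) (4*suc≤4+ {A} 4A≤s)) (ℕ.*-monoˡ-≤ (q *ℕ (E *ℕ E)) 2m≤q) ⟩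
  (4 +ℕ s) *ℕ (4 +ℕ s) *ℕ (q *ℕ (q *ℕ (E *ℕ E)))           ∎
  where
  open ℕ.≤-Reasoning
  regroup : ∀ a m q e → 32 *ℕ ((suc a *ℕ (m *ℕ e)) *ℕ (suc a *ℕ (q *ℕ e)))
                        ≡ (4 *ℕ suc a) *ℕ (4 *ℕ suc a) *ℕ (2 *ℕ m *ℕ (q *ℕ (e *ℕ e)))
  regroup = solve-∀

b≡0-term-bound : ∀ {q m s A} E R → 2 *ℕ m ≤ q → 4 *ℕ A ≤ s →
  32 *ℕ ((suc A *ℕ (m *ℕ E)) *ℕ R) ≤ (4 +ℕ s) *ℕ 4 *ℕ (q *ℕ (E *ℕ R))
b≡0-term-bound {q} {m} {s} {A} E R 2m≤q 4A≤s = begin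
  32 *ℕ ((suc A *ℕ (m *ℕ E)) *ℕ R)                  ≡⟨ regroup A m E R ⟩
  (4 *ℕ suc A) *ℕ 4 *ℕ (2 *ℕ m *ℕ (E *ℕ R))
    ≤⟨ ℕ.*-mono-≤ (ℕ.*-monoˡ-≤ 4 (4*suc≤4+ {A} 4A≤s))
                  (ℕ.*-monoˡ-≤ (E *ℕ R) 2m≤q) ⟩
  (4 +ℕ s) *ℕ 4 *ℕ (q *ℕ (E *ℕ R))                  ∎
  where
  open ℕ.≤-Reasoning
  regroup : ∀ a m e r → 32 *ℕ ((suc a *ℕ (m *ℕ e)) *ℕ r) ≡ (4 *ℕ suc a) *ℕ 4 *ℕ (2 *ℕ m *ℕ (e *ℕ r))
  regroup = solve-∀

-- With s = 1 + t and V = Q + d the difference of the two sides is 32 t Q + (24 + 40 t) d.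
lower-order-absorption : ∀ s Q V → 1 ≤ s → Q ≤ V →
  (4 +ℕ s) *ℕ (4 +ℕ s) *ℕ Q +ℕ (4 +ℕ s) *ℕ 4 *ℕ V ≤ s *ℕ s *ℕ Q +ℕ 44 *ℕ s *ℕ V
lower-order-absorption (suc t) Q V _ Q≤V =
  subst (λ W → (5 +ℕ t) *ℕ (5 +ℕ t) *ℕ Q +ℕ (5 +ℕ t) *ℕ 4 *ℕ W ≤ suc t *ℕ suc t *ℕ Q +ℕ 44 *ℕ suc t *ℕ W)
        (ℕ.m+[n∸m]≡n Q≤V)
        (subst ((5 +ℕ t) *ℕ (5 +ℕ t) *ℕ Q +ℕ (5 +ℕ t) *ℕ 4 *ℕ (Q +ℕ (V ∸ℕ Q)) ≤_)
               (sym (difference t Q (V ∸ℕ Q))) (ℕ.m≤m+n _ _))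
  where
  difference : ∀ t Q d → suc t *ℕ suc t *ℕ Q +ℕ 44 *ℕ suc t *ℕ (Q +ℕ d)
             ≡ ((5 +ℕ t) *ℕ (5 +ℕ t) *ℕ Q +ℕ (5 +ℕ t) *ℕ 4 *ℕ (Q +ℕ d)) +ℕ (32 *ℕ t *ℕ Q +ℕ (24 +ℕ 40 *ℕ t) *ℕ d)
  difference = solve-∀

module _ (K : FiniteField) where
  open FiniteField K
  open FieldOps K

  private
    ring : CommutativeRing _ _
    ring = record { isCommutativeRing = isCommRing }
  open CommutativeRing ring
    using (+-identityˡ; +-identityʳ; zeroˡ; zeroʳ; *-comm; *-assoc; +-assoc; distribˡ; *-identityˡ; *-identityʳ)
  open RingProperties (CommutativeRing.ring ring) using (-0#≈0#; -‿involutive; +-cancelˡ)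

  2≤card : 2 ≤ card
  2≤card = unique-⊆⇒length≤ ((0≢1 ∷ []) ∷ [] ∷ []) (λ _ → elems-complete _)

  ¬2∣card⇒1+1≢0 : ¬ 2 ∣ card → (1# + 1#) ≢ 0#
  ¬2∣card⇒1+1≢0 ¬2∣card 1+1≡0 =
    ¬2∣card (involution⇒2∣length _≟_ (_+ 1#) involutive no-fixpoint elems-unique (λ _ → elems-complete _))
    where
    involutive : ∀ x → ((x + 1#) + 1#) ≡ x
    involutive x = trans (+-assoc x 1# 1#) (trans (cong (x +_) 1+1≡0) (+-identityʳ x))
    no-fixpoint : ∀ x → (x + 1#) ≢ x
    no-fixpoint x x+1≡x = 0≢1 (sym (+-cancelˡ x 1# 0# (trans x+1≡x (sym (+-identityʳ x)))))

  *-nonzero : ∀ {x y} → x ≢ 0# → y ≢ 0# → (x * y) ≢ 0#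
  *-nonzero {x} {y} x≢0 y≢0 xy≡0 with inverse x x≢0
  ... | x⁻¹ , xx⁻¹≡1 = y≢0 (begin
    y                ≡⟨ sym (*-identityˡ y) ⟩
    1# * y           ≡⟨ cong (_* y) (sym (trans (*-comm x⁻¹ x) xx⁻¹≡1)) ⟩
    (x⁻¹ * x) * y    ≡⟨ *-assoc x⁻¹ x y ⟩
    x⁻¹ * (x * y)    ≡⟨ cong (x⁻¹ *_) xy≡0 ⟩
    x⁻¹ * 0#         ≡⟨ zeroʳ x⁻¹ ⟩
    0#               ∎)
    where open ≡-Reasoning

  -‿nonzero : ∀ {x} → x ≢ 0# → (- x) ≢ 0#
  -‿nonzero {x} x≢0 -x≡0 = x≢0 (trans (sym (-‿involutive x)) (trans (cong -_ -x≡0) -0#≈0#))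

  natF4≡2*2 : natF 4 ≡ ((1# + 1#) * (1# + 1#))
  natF4≡2*2 = begin
    1# + (1# + (1# + (1# + 0#)))          ≡⟨ cong (λ z → 1# + (1# + (1# + z))) (+-identityʳ 1#) ⟩
    1# + (1# + (1# + 1#))                 ≡⟨ sym (+-assoc 1# 1# (1# + 1#)) ⟩
    (1# + 1#) + (1# + 1#)                 ≡⟨ sym (cong₂ _+_ (*-identityʳ (1# + 1#)) (*-identityʳ (1# + 1#))) ⟩
    ((1# + 1#) * 1#) + ((1# + 1#) * 1#)   ≡⟨ sym (distribˡ (1# + 1#) 1# 1#) ⟩
    (1# + 1#) * (1# + 1#)                 ∎
    where open ≡-Reasoning

  coef : Poly → ℕ → F
  coef []      n       = 0#
  coef (x ∷ p) zero    = x
  coef (x ∷ p) (suc n) = coef p n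

  coef-addP : ∀ p q n → coef (addP p q) n ≡ (coef p n + coef q n)
  coef-addP []      q       n       = sym (+-identityˡ _)
  coef-addP (x ∷ p) []      n       = sym (+-identityʳ _)
  coef-addP (x ∷ p) (y ∷ q) zero    = refl
  coef-addP (x ∷ p) (y ∷ q) (suc n) = coef-addP p q n

  coef-scaleP : ∀ c p n → coef (scaleP c p) n ≡ (c * coef p n)
  coef-scaleP c []      n       = sym (zeroʳ c)
  coef-scaleP c (x ∷ p) zero    = refl
  coef-scaleP c (x ∷ p) (suc n) = coef-scaleP c p n

  coef-negP : ∀ p n → coef (negP p) n ≡ (- coef p n)
  coef-negP []      n       = sym -0#≈0#
  coef-negP (x ∷ p) zero    = refl
  coef-negP (x ∷ p) (suc n) = coef-negP p n

  coef-subP : ∀ p q n → coef (subP p q) n ≡ (coef p n + (- coef q n))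
  coef-subP p q n = trans (coef-addP p (negP q) n) (cong (coef p n +_) (coef-negP q n))

  coef-mulP-∷ : ∀ x p q n → coef (mulP (x ∷ p) q) n ≡ ((x * coef q n) + coef (0# ∷ mulP p q) n)
  coef-mulP-∷ x p q n =
    trans (coef-addP (scaleP x q) (0# ∷ mulP p q) n) (cong (_+ coef (0# ∷ mulP p q) n) (coef-scaleP x q n))

  coef-mulP-[] : ∀ p n → coef (mulP p []) n ≡ 0#
  coef-mulP-[] []      n       = refl
  coef-mulP-[] (x ∷ p) zero    = refl
  coef-mulP-[] (x ∷ p) (suc n) = coef-mulP-[] p n

  IsZero : Poly → Set
  IsZero p = ∀ n → coef p n ≡ 0#

  DegreeAtMost : ℕ → Poly → Set
  DegreeAtMost i p = ∀ n → i < n → coef p n ≡ 0#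

  isZero-0∷ : ∀ p → IsZero p → IsZero (0# ∷ p)
  isZero-0∷ p z zero    = refl
  isZero-0∷ p z (suc n) = z n

  coef-mulP-∷-vanishes : ∀ x p q n → (x * coef q n) ≡ 0# → coef (0# ∷ mulP p q) n ≡ 0# →
                         coef (mulP (x ∷ p) q) n ≡ 0#
  coef-mulP-∷-vanishes x p q n xqₙ≡0 tail≡0 = begin
    coef (mulP (x ∷ p) q) n                   ≡⟨ coef-mulP-∷ x p q n ⟩
    (x * coef q n) + coef (0# ∷ mulP p q) n   ≡⟨ cong₂ _+_ xqₙ≡0 tail≡0 ⟩
    0# + 0#                                   ≡⟨ +-identityʳ 0# ⟩
    0#                                        ∎
    where open ≡-Reasoning

  mulP-isZeroˡ : ∀ p q → IsZero p → IsZero (mulP p q)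
  mulP-isZeroˡ []      q z n = refl
  mulP-isZeroˡ (x ∷ p) q z n =
    coef-mulP-∷-vanishes x p q n (trans (cong (_* coef q n) (z 0)) (zeroˡ _))
      (isZero-0∷ _ (mulP-isZeroˡ p q (λ k → z (suc k))) n)

  mulP-degreeAtMost : ∀ i j p q → DegreeAtMost i p → DegreeAtMost j q → DegreeAtMost (i +ℕ j) (mulP p q)
  mulP-degreeAtMost i       j []      q dp dq n       _ = refl
  mulP-degreeAtMost zero    j (x ∷ p) q dp dq (suc n) j<n =
    coef-mulP-∷-vanishes x p q (suc n) (trans (cong (x *_) (dq (suc n) j<n)) (zeroʳ x))
      (mulP-isZeroˡ p q (λ k → dp (suc k) z<s) n)
  mulP-degreeAtMost (suc i) j (x ∷ p) q dp dq (suc n) (s≤s i+j<n) =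
    coef-mulP-∷-vanishes x p q (suc n) (trans (cong (x *_) (dq (suc n) j<n)) (zeroʳ x))
      (mulP-degreeAtMost i j p q (λ k i<k → dp (suc k) (s≤s i<k)) dq n i+j<n)
    where
    j<n = ℕ.m≤n⇒m≤1+n (ℕ.≤-trans (s≤s (ℕ.m≤n+m j i)) i+j<n)

  coef-mulP-top : ∀ i j p q → DegreeAtMost i p → DegreeAtMost j q →
                  coef (mulP p q) (i +ℕ j) ≡ (coef p i * coef q j)
  coef-mulP-top i       j []      q dp dq = sym (zeroˡ _)
  coef-mulP-top zero    j (x ∷ p) q dp dq = begin
    coef (mulP (x ∷ p) q) j                   ≡⟨ coef-mulP-∷ x p q j ⟩
    (x * coef q j) + coef (0# ∷ mulP p q) j   ≡⟨ cong ((x * coef q j) +_) (tail j) ⟩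
    (x * coef q j) + 0#                       ≡⟨ +-identityʳ _ ⟩
    x * coef q j                              ∎
    where
    open ≡-Reasoning
    tail : IsZero (0# ∷ mulP p q)
    tail zero    = refl
    tail (suc n) = mulP-isZeroˡ p q (λ k → dp (suc k) z<s) n
  coef-mulP-top (suc i) j (x ∷ p) q dp dq = begin
    coef (mulP (x ∷ p) q) (suc (i +ℕ j))                  ≡⟨ coef-mulP-∷ x p q (suc (i +ℕ j)) ⟩
    (x * coef q (suc (i +ℕ j))) + coef (mulP p q) (i +ℕ j) ≡⟨ cong₂ _+_ x*0≡0 (coef-mulP-top i j p q dp′ dq) ⟩
    0# + (coef p i * coef q j)                            ≡⟨ +-identityˡ _ ⟩
    coef p i * coef q j                                   ∎
    where
    open ≡-Reasoning
    dp′ : DegreeAtMost i p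
    dp′ k i<k = dp (suc k) (s≤s i<k)
    x*0≡0 : (x * coef q (suc (i +ℕ j))) ≡ 0#
    x*0≡0 = trans (cong (x *_) (dq _ (s≤s (ℕ.m≤n+m j i)))) (zeroʳ x)

  coef-strip : ∀ p n → coef (strip p) n ≡ coef p n
  coef-strip []      n       = refl
  coef-strip (x ∷ p) n       with strip p | coef-strip p
  coef-strip (x ∷ p) zero    | _ ∷ _ | _  = refl
  coef-strip (x ∷ p) (suc n) | _ ∷ _ | ih = ih n
  coef-strip (x ∷ p) n       | []    | ih with x ≟ 0#
  coef-strip (x ∷ p) zero    | []    | ih | yes x≡0 = sym x≡0
  coef-strip (x ∷ p) (suc n) | []    | ih | yes _   = ih n
  coef-strip (x ∷ p) zero    | []    | ih | no _    = refl
  coef-strip (x ∷ p) (suc n) | []    | ih | no _    = ih n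

  strip-leading≢0 : ∀ p → strip p ≢ [] → coef (strip p) (deg p) ≢ 0#
  strip-leading≢0 []      ne = contradiction refl ne
  strip-leading≢0 (x ∷ p) ne with strip p | strip-leading≢0 p
  ... | _ ∷ _ | ih = ih (λ ())
  ... | []    | _ with x ≟ 0#
  ...   | yes _   = contradiction refl ne
  ...   | no x≢0 = x≢0

  leading≢0 : ∀ p → strip p ≢ [] → coef p (deg p) ≢ 0#
  leading≢0 p ne e = strip-leading≢0 p ne (trans (coef-strip p (deg p)) e)

  coef≢0⇒≤deg : ∀ p n → coef p n ≢ 0# → n ≤ deg p
  coef≢0⇒≤deg p n pn≢0 = <⇒≤∸1 (coef≢0⇒< (strip p) n (λ e → pn≢0 (trans (sym (coef-strip p n)) e)))
    where
    coef≢0⇒< : ∀ l n → coef l n ≢ 0# → n < length l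
    coef≢0⇒< []      n       ln≢0 = contradiction refl ln≢0
    coef≢0⇒< (x ∷ l) zero    _    = z<s
    coef≢0⇒< (x ∷ l) (suc n) ln≢0 = s≤s (coef≢0⇒< l n ln≢0)
    <⇒≤∸1 : ∀ {n L} → n < L → n ≤ L ∸ℕ 1
    <⇒≤∸1 (s≤s n≤L) = n≤L

  coef≢0⇒strip≢[] : ∀ p n → coef p n ≢ 0# → strip p ≢ []
  coef≢0⇒strip≢[] p n pn≢0 e = pn≢0 (trans (sym (coef-strip p n)) (cong (λ l → coef l n) e))

  degreeAtMost-deg : ∀ p → DegreeAtMost (deg p) p
  degreeAtMost-deg p n deg<n with coef p n ≟ 0#
  ... | yes pn≡0 = pn≡0
  ... | no pn≢0  = contradiction (coef≢0⇒≤deg p n pn≢0) (ℕ.<⇒≱ deg<n)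

  mulP-leading≢0 : ∀ p q → strip p ≢ [] → strip q ≢ [] → coef (mulP p q) (deg p +ℕ deg q) ≢ 0#
  mulP-leading≢0 p q p≢0 q≢0 e =
    *-nonzero (leading≢0 p p≢0) (leading≢0 q q≢0)
      (trans (sym (coef-mulP-top (deg p) (deg q) p q (degreeAtMost-deg p) (degreeAtMost-deg q))) e)

  DegLe⇒≤ : ∀ k p m → strip p ≢ [] → DegLe k p m → k *ℕ deg p ≤ m
  DegLe⇒≤ k p m p≢0 (inj₁ p≡0) = contradiction p≡0 p≢0
  DegLe⇒≤ k p m p≢0 (inj₂ kdeg≤m) = kdeg≤m

  DegLe-mulP⇒≤ : ∀ k p q m → strip p ≢ [] → strip q ≢ [] → DegLe k (mulP p q) m → k *ℕ (deg p +ℕ deg q) ≤ m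
  DegLe-mulP⇒≤ k p q m p≢0 q≢0 pq≤m = ℕ.≤-trans (ℕ.*-monoʳ-≤ k deg-pq≤) (DegLe⇒≤ k (mulP p q) m pq≢0 pq≤m)
    where
    leading = mulP-leading≢0 p q p≢0 q≢0
    pq≢0 = coef≢0⇒strip≢[] (mulP p q) _ leading
    deg-pq≤ = coef≢0⇒≤deg (mulP p q) _ leading

  normalized≢[] : ∀ p → Normalized p → p ≢ [] → strip p ≢ []
  normalized≢[] p p-norm p≢[] e = p≢[] (trans (sym p-norm) e)

  length≡suc-deg : ∀ p → Normalized p → p ≢ [] → length p ≡ suc (deg p)
  length≡suc-deg []      _      p≢[] = contradiction refl p≢[]
  length≡suc-deg (x ∷ p) p-norm _    = cong (λ l → suc (length l ∸ℕ 1)) (sym p-norm)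

  length≤suc : ∀ p B → Normalized p → (strip p ≢ [] → deg p ≤ B) → length p ≤ suc B
  length≤suc []      B _      _      = z≤n
  length≤suc (x ∷ p) B p-norm deg≤B =
    subst (_≤ suc B) (sym (length≡suc-deg (x ∷ p) p-norm (λ ()))) (s≤s (deg≤B (normalized≢[] (x ∷ p) p-norm (λ ()))))

  strip-∷-cong : ∀ x {p p′} → strip p ≡ strip p′ → strip (x ∷ p) ≡ strip (x ∷ p′)
  strip-∷-cong x {p} {p′} e with strip p | strip p′ | e
  ... | r | .r | refl = refl

  strip-padding : ∀ p k → strip (p ++ replicate k 0#) ≡ strip p
  strip-padding []      zero    = refl
  strip-padding []      (suc k) = trans (strip-∷-cong 0# {replicate k 0#} {[]} (strip-padding [] k)) 0∷[]
    where
    0∷[] : strip (0# ∷ []) ≡ []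
    0∷[] with 0# ≟ 0#
    ... | yes _   = refl
    ... | no 0≢0 = contradiction refl 0≢0
  strip-padding (x ∷ p) k = strip-∷-cong x {p ++ replicate k 0#} {p} (strip-padding p k)

  coef-disc-b≡0 : ∀ a c d n → coef (mulP (mulP a a) (mulP d d)) n ≡ 0# →
                  coef (disc (form a [] c d)) n ≡ (- (natF 4 * coef (mulP a (mulP c (mulP c c))) n))
  coef-disc-b≡0 a c d n a²d²≡0 = begin
    coef (disc (form a [] c d)) n
      ≡⟨ expand ⟩
    ((((natF 18 * coef Z n) + 0#) + (- (natF 4 * coef X n))) + (- 0#)) + (- (natF 27 * coef Y n))
      ≡⟨ cong₂ (λ z y → ((((natF 18 * z) + 0#) + (- (natF 4 * coef X n))) + (- 0#)) + (- (natF 27 * y)))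
               (mulP-isZeroˡ (mulP a []) (mulP c d) (coef-mulP-[] a) n) a²d²≡0 ⟩
    ((((natF 18 * 0#) + 0#) + (- (natF 4 * coef X n))) + (- 0#)) + (- (natF 27 * 0#))
      ≡⟨ simplify (natF 18) (natF 27) (- (natF 4 * coef X n)) ⟩
    - (natF 4 * coef X n) ∎
    where
    open ≡-Reasoning
    X = mulP a (mulP c (mulP c c))
    Y = mulP (mulP a a) (mulP d d)
    Z = mulP (mulP a []) (mulP c d)
    S₁ = addP (scaleP (natF 18) Z) []
    S₂ = subP S₁ (scaleP (natF 4) X)
    S₃ = subP S₂ []
    expand : coef (disc (form a [] c d)) n ≡
             (((((natF 18 * coef Z n) + 0#) + (- (natF 4 * coef X n))) + (- 0#)) + (- (natF 27 * coef Y n)))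
    expand = trans (coef-subP S₃ (scaleP (natF 27) Y) n) (cong₂ _+_
               (trans (coef-subP S₂ [] n) (cong (_+ (- 0#))
                 (trans (coef-subP S₁ (scaleP (natF 4) X) n) (cong₂ _+_
                   (trans (coef-addP (scaleP (natF 18) Z) [] n) (cong (_+ 0#) (coef-scaleP (natF 18) Z n)))
                   (cong -_ (coef-scaleP (natF 4) X n))))))
               (cong -_ (coef-scaleP (natF 27) Y n)))
    simplify : ∀ u w v → ((((u * 0#) + 0#) + v) + (- 0#)) + (- (w * 0#)) ≡ v
    simplify u w v rewrite zeroʳ u | zeroʳ w | -0#≈0# | +-identityʳ 0# | +-identityˡ v | +-identityʳ v = +-identityʳ v

  coef-a²d²-vanishes : ∀ a d n → 2 *ℕ (deg a +ℕ deg d) < n → coef (mulP (mulP a a) (mulP d d)) n ≡ 0#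
  coef-a²d²-vanishes a d n 2ad<n =
    mulP-degreeAtMost (deg a +ℕ deg a) (deg d +ℕ deg d) (mulP a a) (mulP d d)
      (mulP-degreeAtMost _ _ a a (degreeAtMost-deg a) (degreeAtMost-deg a))
      (mulP-degreeAtMost _ _ d d (degreeAtMost-deg d) (degreeAtMost-deg d))
      n (subst (_< n) (double-sum (deg a) (deg d)) 2ad<n)
    where
    double-sum : ∀ x y → 2 *ℕ (x +ℕ y) ≡ (x +ℕ x) +ℕ (y +ℕ y)
    double-sum = solve-∀

  coef-ac³-top : ∀ a c → coef (mulP a (mulP c (mulP c c))) (deg a +ℕ 3 *ℕ deg c)
                         ≡ (coef a (deg a) * (coef c (deg c) * (coef c (deg c) * coef c (deg c))))
  coef-ac³-top a c = begin
    coef (mulP a (mulP c (mulP c c))) (α +ℕ 3 *ℕ γ)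
      ≡⟨ cong (λ e → coef (mulP a (mulP c (mulP c c))) (α +ℕ e)) (triple γ) ⟨
    coef (mulP a (mulP c (mulP c c))) (α +ℕ (γ +ℕ (γ +ℕ γ)))
      ≡⟨ coef-mulP-top α _ a _ (degreeAtMost-deg a) (mulP-degreeAtMost γ (γ +ℕ γ) c _ dc dc²) ⟩
    coef a α * coef (mulP c (mulP c c)) (γ +ℕ (γ +ℕ γ))
      ≡⟨ cong (coef a α *_) (coef-mulP-top γ (γ +ℕ γ) c _ dc dc²) ⟩
    coef a α * (coef c γ * coef (mulP c c) (γ +ℕ γ))
      ≡⟨ cong (λ z → coef a α * (coef c γ * z)) (coef-mulP-top γ γ c c dc dc) ⟩
    coef a α * (coef c γ * (coef c γ * coef c γ)) ∎
    where
    open ≡-Reasoning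
    α = deg a
    γ = deg c
    dc = degreeAtMost-deg c
    dc² = mulP-degreeAtMost γ γ c c dc dc
    triple : ∀ x → x +ℕ (x +ℕ x) ≡ 3 *ℕ x
    triple = solve-∀

  -- For b = 0 the discriminant is -4ac³ - 27a²d², and when deg(a²d²) ≤ deg D the term 4ac³ cannot exceed
  -- deg D without being its leading term; this is where 4 ≠ 0 in F_q is needed.
  disc-b≡0-degree : (1# + 1#) ≢ 0# → ∀ a c d → strip a ≢ [] → strip c ≢ [] →
                    2 *ℕ (deg a +ℕ deg d) ≤ deg (disc (form a [] c d)) →
                    deg a +ℕ 3 *ℕ deg c ≤ deg (disc (form a [] c d))
  disc-b≡0-degree 1+1≢0 a c d a≢0 c≢0 2ad≤D with deg a +ℕ 3 *ℕ deg c ℕ.≤? deg (disc (form a [] c d))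
  ... | yes n≤D = n≤D
  ... | no n≰D = contradiction (coef≢0⇒≤deg (disc (form a [] c d)) _ discₙ≢0) n≰D
    where
    4≢0 : natF 4 ≢ 0#
    4≢0 4≡0 = *-nonzero 1+1≢0 1+1≢0 (trans (sym natF4≡2*2) 4≡0)
    lc = leading≢0 c c≢0
    discₙ≡ : coef (disc (form a [] c d)) (deg a +ℕ 3 *ℕ deg c)
             ≡ (- (natF 4 * (coef a (deg a) * (coef c (deg c) * (coef c (deg c) * coef c (deg c))))))
    discₙ≡ = trans (coef-disc-b≡0 a c d _ (coef-a²d²-vanishes a d _ (ℕ.≤-<-trans 2ad≤D (ℕ.≰⇒> n≰D))))
                   (cong (λ z → - (natF 4 * z)) (coef-ac³-top a c))
    discₙ≢0 : coef (disc (form a [] c d)) (deg a +ℕ 3 *ℕ deg c) ≢ 0#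
    discₙ≢0 = subst (_≢ 0#) (sym discₙ≡)
                (-‿nonzero (*-nonzero 4≢0 (*-nonzero (leading≢0 a a≢0) (*-nonzero lc (*-nonzero lc lc)))))

  polys : ℕ → List Poly
  polys zero    = [ [] ]
  polys (suc n) = cartesianProductWith _∷_ elems (polys n)

  length-polys : ∀ n → length (polys n) ≡ card ^ n
  length-polys zero    = refl
  length-polys (suc n) =
    trans (length-cartesianProductWith _∷_ elems (polys n)) (cong (card *ℕ_) (length-polys n))

  ∈-polys : ∀ p → p ∈ polys (length p)
  ∈-polys []      = here refl
  ∈-polys (x ∷ p) = ∈-cartesianProductWith⁺ _∷_ (elems-complete x) (∈-polys p)

  -- Every normalized polynomial with at most n coefficients, listed with repetitions; only the length q^n matters.
  shortPolys : ℕ → List Poly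
  shortPolys n = map strip (polys n)

  length-shortPolys : ∀ n → length (shortPolys n) ≡ card ^ n
  length-shortPolys n = trans (length-map strip (polys n)) (length-polys n)

  ∈-shortPolys : ∀ p n → Normalized p → length p ≤ n → p ∈ shortPolys n
  ∈-shortPolys p n p-norm p≤n =
    subst (_∈ shortPolys n) (trans (strip-padding p (n ∸ℕ length p)) p-norm)
      (∈-map⁺ strip (subst (λ k → padded ∈ polys k) length-padded (∈-polys padded)))
    where
    padded = p ++ replicate (n ∸ℕ length p) 0#
    length-padded : length padded ≡ n
    length-padded = trans (length-++ p)
      (trans (cong (length p +ℕ_) (length-replicate (n ∸ℕ length p))) (ℕ.m+[n∸m]≡n p≤n))

  polysWithLeading : List F → ℕ → List Poly
  polysWithLeading leads i = cartesianProductWith _∷ʳ_ (polys i) leads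

  length-polysWithLeading : ∀ leads i → length (polysWithLeading leads i) ≡ card ^ i *ℕ length leads
  length-polysWithLeading leads i =
    trans (length-cartesianProductWith _∷ʳ_ (polys i) leads) (cong (_*ℕ length leads) (length-polys i))

  ∈-polysWithLeading : ∀ {leads y} p → Normalized p → last p ≡ just y → y ∈ leads →
                       p ∈ polysWithLeading leads (deg p)
  ∈-polysWithLeading p p-norm last≡y y∈leads with initLast p
  ∈-polysWithLeading .[] p-norm () y∈leads | []
  ∈-polysWithLeading .(xs ∷ʳ x) p-norm last≡y y∈leads | xs ∷ʳ′ x =
    subst (λ k → xs ∷ʳ x ∈ polysWithLeading _ k) length-xs
      (∈-cartesianProductWith⁺ _∷ʳ_ (∈-polys xs)
        (subst (_∈ _) (sym (just-injective (trans (sym (last-∷ʳ xs x)) last≡y))) y∈leads))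
    where
    length-xs : length xs ≡ deg (xs ∷ʳ x)
    length-xs = begin
      length xs                        ≡⟨ ℕ.m+n∸n≡m (length xs) 1 ⟨
      (length xs +ℕ 1) ∸ℕ 1            ≡⟨ cong (_∸ℕ 1) (length-++ xs) ⟨
      length (xs ∷ʳ x) ∸ℕ 1            ≡⟨ cong (λ l → length l ∸ℕ 1) p-norm ⟨
      deg (xs ∷ʳ x)                    ∎
      where open ≡-Reasoning

  degreeSplitPairs : (ℕ → List Poly) → ℕ → ℕ → List (Poly × Poly)
  degreeSplitPairs first A M =
    concatMap (λ i → cartesianProduct (first i) (shortPolys (suc (M ∸ℕ i)))) (upTo (suc A))

  ∈-degreeSplitPairs : ∀ first A M {i x y} → x ∈ first i → i ≤ A → Normalized y → length y ≤ suc (M ∸ℕ i) →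
                       (x , y) ∈ degreeSplitPairs first A M
  ∈-degreeSplitPairs first A M x∈ i≤A y-norm y≤ =
    ∈-concatMap⁺′ _ (∈-upTo⁺ (s≤s i≤A)) (∈-cartesianProductWith⁺ _,_ x∈ (∈-shortPolys _ _ y-norm y≤))

  length-degreeSplitPairs : ∀ first A M k → A ≤ M → (∀ i → length (first i) ≡ card ^ i *ℕ k) →
                            length (degreeSplitPairs first A M) ≡ suc A *ℕ (k *ℕ card ^ suc M)
  length-degreeSplitPairs first A M k A≤M length-first =
    trans (length-concatMap-const (λ i → cartesianProduct (first i) (shortPolys (suc (M ∸ℕ i))))
                                  (upTo (suc A)) (k *ℕ card ^ suc M) block)
          (cong (_*ℕ (k *ℕ card ^ suc M)) (length-upTo (suc A)))
    where
    block : ∀ {i} → i ∈ upTo (suc A) →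
            length (cartesianProduct (first i) (shortPolys (suc (M ∸ℕ i)))) ≡ k *ℕ card ^ suc M
    block {i} i∈ = begin
      length (cartesianProduct (first i) (shortPolys (suc (M ∸ℕ i))))
        ≡⟨ length-cartesianProductWith _,_ (first i) _ ⟩
      length (first i) *ℕ length (shortPolys (suc (M ∸ℕ i)))
        ≡⟨ cong₂ _*ℕ_ (length-first i) (length-shortPolys (suc (M ∸ℕ i))) ⟩
      card ^ i *ℕ k *ℕ card ^ suc (M ∸ℕ i)
        ≡⟨ trans (cong (_*ℕ card ^ suc (M ∸ℕ i)) (ℕ.*-comm (card ^ i) k)) (ℕ.*-assoc k (card ^ i) _) ⟩
      k *ℕ (card ^ i *ℕ card ^ suc (M ∸ℕ i))
        ≡⟨ cong (k *ℕ_) (ℕ.^-distribˡ-+-* card i (suc (M ∸ℕ i))) ⟨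
      k *ℕ card ^ (i +ℕ suc (M ∸ℕ i))
        ≡⟨ cong (λ e → k *ℕ card ^ e) (trans (ℕ.+-suc i (M ∸ℕ i)) (cong suc (ℕ.m+[n∸m]≡n i≤M))) ⟩
      k *ℕ card ^ suc M ∎
      where
      open ≡-Reasoning
      i≤M = ℕ.≤-trans (ℕ.≤-pred (∈-upTo⁻ i∈)) A≤M

  module _ (h : F) (s : ℕ) where

    leadingCoefficients : List F
    leadingCoefficients = map (pow h) (upTo (suc ((card ∸ℕ 3) / 2)))

    adPairs : List (Poly × Poly)
    adPairs = degreeSplitPairs (polysWithLeading leadingCoefficients) (s / 4) (s / 2)

    bcPairs : List (Poly × Poly)
    bcPairs = degreeSplitPairs (λ i → shortPolys (suc i)) (s / 4) (s / 2)

    assemble : Poly × Poly → Poly × Poly → Form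
    assemble (a , d) (b , c) = form a b c d

    assemble-b≡0 : Poly × Poly → Poly → Form
    assemble-b≡0 (a , d) c = form a [] c d

    candidates : List Form
    candidates = cartesianProductWith assemble adPairs bcPairs
              ++ cartesianProductWith assemble-b≡0 adPairs (shortPolys (suc (s / 3)))

    length-candidates :
      length candidates ≡ length adPairs *ℕ length bcPairs +ℕ length adPairs *ℕ card ^ suc (s / 3)
    length-candidates = trans (length-++ (cartesianProductWith assemble adPairs bcPairs)) (cong₂ _+ℕ_
      (length-cartesianProductWith assemble adPairs bcPairs)
      (trans (length-cartesianProductWith assemble-b≡0 adPairs _)
             (cong (length adPairs *ℕ_) (length-shortPolys (suc (s / 3))))))

    s/4≤s/2 : s / 4 ≤ s / 2
    s/4≤s/2 = /-monoʳ-≤ s {4} {2} (s≤s (s≤s z≤n))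

    length-adPairs : length adPairs ≡ suc (s / 4) *ℕ (suc ((card ∸ℕ 3) / 2) *ℕ card ^ suc (s / 2))
    length-adPairs =
      length-degreeSplitPairs (polysWithLeading leadingCoefficients) (s / 4) (s / 2) (suc ((card ∸ℕ 3) / 2))
        s/4≤s/2 λ i →
      trans (length-polysWithLeading leadingCoefficients i)
            (cong (card ^ i *ℕ_) (trans (length-map (pow h) (upTo (suc ((card ∸ℕ 3) / 2)))) (length-upTo _)))

    length-bcPairs : length bcPairs ≡ suc (s / 4) *ℕ (card *ℕ card ^ suc (s / 2))
    length-bcPairs = length-degreeSplitPairs (λ i → shortPolys (suc i)) (s / 4) (s / 2) card s/4≤s/2 λ i →
      trans (length-shortPolys (suc i)) (ℕ.*-comm card (card ^ i))

    length≤cofactor : ∀ x y → strip x ≢ [] → Normalized y → DegLe 2 (mulP x y) s →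
                      length y ≤ suc (s / 2 ∸ℕ deg x)
    length≤cofactor x y x≢0 y-norm xy≤s = length≤suc y _ y-norm λ y≢0 →
      subst (_≤ s / 2 ∸ℕ deg x) (ℕ.m+n∸m≡n (deg x) (deg y))
        (ℕ.∸-monoˡ-≤ (deg x) (*≤⇒≤/ 2 (deg x +ℕ deg y) s (DegLe-mulP⇒≤ 2 x y s x≢0 y≢0 xy≤s)))

    ∈-adPairs : ∀ a d → Normalized a → Normalized d → a ≢ [] → d ≢ [] →
                DegLe 4 a s → DegLe 2 (mulP a d) s → SgnInS h a → (a , d) ∈ adPairs
    ∈-adPairs a d a-norm d-norm a≢[] d≢[] a≤s ad≤s (j , 2j≤q-3 , lead-a) =
      ∈-degreeSplitPairs (polysWithLeading leadingCoefficients) (s / 4) (s / 2)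
        a∈ (*≤⇒≤/ 4 (deg a) s (DegLe⇒≤ 4 a s a≢0 a≤s))
        d-norm (length≤cofactor a d a≢0 d-norm ad≤s)
      where
      a≢0 = normalized≢[] a a-norm a≢[]
      a∈ : a ∈ polysWithLeading leadingCoefficients (deg a)
      a∈ = ∈-polysWithLeading a a-norm (subst (λ l → last l ≡ just (pow h j)) a-norm lead-a)
             (∈-map⁺ (pow h) (∈-upTo⁺ (s≤s (*≤⇒≤/ 2 j (card ∸ℕ 3) 2j≤q-3))))

    ∈-bcPairs : ∀ b c → Normalized b → Normalized c → strip b ≢ [] →
                DegLe 4 b s → DegLe 2 (mulP b c) s → (b , c) ∈ bcPairs
    ∈-bcPairs b c b-norm c-norm b≢0 b≤s bc≤s =
      ∈-degreeSplitPairs (λ i → shortPolys (suc i)) (s / 4) (s / 2)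
        b∈ (*≤⇒≤/ 4 (deg b) s (DegLe⇒≤ 4 b s b≢0 b≤s))
        c-norm (length≤cofactor b c b≢0 c-norm bc≤s)
      where
      b∈ : b ∈ shortPolys (suc (deg b))
      b∈ = ∈-shortPolys b _ b-norm (length≤suc b (deg b) b-norm λ _ → ℕ.≤-refl)

    Fs⊆candidates : (1# + 1#) ≢ 0# → ∀ {f} → InFs h s f → f ∈ candidates
    Fs⊆candidates 1+1≢0 {form a [] c d}
        (a-norm , _ , c-norm , d-norm , a≢[] , d≢[] , _ , _ , _ , D≡s , a≤s , _ , ad≤s , _ , sgn) =
      ∈-++⁺ʳ _ (∈-cartesianProductWith⁺ assemble-b≡0 (∈-adPairs a d a-norm d-norm a≢[] d≢[] a≤s ad≤s sgn) c∈)
      where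
      a≢0 = normalized≢[] a a-norm a≢[]
      d≢0 = normalized≢[] d d-norm d≢[]
      3c≤s : strip c ≢ [] → 3 *ℕ deg c ≤ s
      3c≤s c≢0 = ℕ.≤-trans (ℕ.m≤n+m _ (deg a)) (subst (deg a +ℕ 3 *ℕ deg c ≤_) D≡s
                   (disc-b≡0-degree 1+1≢0 a c d a≢0 c≢0 (subst (2 *ℕ (deg a +ℕ deg d) ≤_) (sym D≡s)
                     (DegLe-mulP⇒≤ 2 a d s a≢0 d≢0 ad≤s))))
      c∈ : c ∈ shortPolys (suc (s / 3))
      c∈ = ∈-shortPolys c _ c-norm (length≤suc c _ c-norm λ c≢0 → *≤⇒≤/ 3 (deg c) s (3c≤s c≢0))
    Fs⊆candidates 1+1≢0 {form a b@(_ ∷ _) c d}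
        (a-norm , b-norm , c-norm , d-norm , a≢[] , d≢[] , _ , _ , _ , _ , a≤s , b≤s , ad≤s , bc≤s , sgn) =
      ∈-++⁺ˡ (∈-cartesianProductWith⁺ assemble (∈-adPairs a d a-norm d-norm a≢[] d≢[] a≤s ad≤s sgn)
        (∈-bcPairs b c b-norm c-norm (normalized≢[] b b-norm λ ()) b≤s bc≤s))

    length-Fs≤ : (1# + 1#) ≢ 0# → ∀ xs → Unique xs → All (InFs h s) xs → length xs ≤ length candidates
    length-Fs≤ 1+1≢0 xs u xs∈Fs = unique-⊆⇒length≤ u (λ f∈xs → Fs⊆candidates 1+1≢0 (All.lookup xs∈Fs f∈xs))

    Fs-count-bound : (1# + 1#) ≢ 0# → 1 ≤ s → ∀ xs → Unique xs → All (InFs h s) xs →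
      32 *ℕ length xs ≤ card ^ (4 ∸ℕ s % 2) *ℕ (s *ℕ s) *ℕ card ^ s +ℕ 44 *ℕ card ^ 4 *ℕ s *ℕ card ^ s
    Fs-count-bound 1+1≢0 1≤s xs u xs∈Fs = begin
      32 *ℕ length xs
        ≤⟨ ℕ.*-monoʳ-≤ 32 (length-Fs≤ 1+1≢0 xs u xs∈Fs) ⟩
      32 *ℕ length candidates
        ≡⟨ trans (cong (32 *ℕ_) length-candidates)
                 (ℕ.*-distribˡ-+ 32 (length adPairs *ℕ length bcPairs) (length adPairs *ℕ R)) ⟩
      32 *ℕ (length adPairs *ℕ length bcPairs) +ℕ 32 *ℕ (length adPairs *ℕ R)
        ≡⟨ cong₂ (λ x y → 32 *ℕ (x *ℕ y) +ℕ 32 *ℕ (x *ℕ R)) length-adPairs length-bcPairs ⟩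
      32 *ℕ ((suc A *ℕ (m *ℕ E)) *ℕ (suc A *ℕ (q *ℕ E))) +ℕ 32 *ℕ ((suc A *ℕ (m *ℕ E)) *ℕ R)
        ≤⟨ ℕ.+-mono-≤ (dominant-term-bound {q} {m} {s} {A} E 2m≤q 4A≤s)
                      (b≡0-term-bound {q} {m} {s} {A} E R 2m≤q 4A≤s) ⟩
      (4 +ℕ s) *ℕ (4 +ℕ s) *ℕ (q *ℕ (q *ℕ (E *ℕ E))) +ℕ (4 +ℕ s) *ℕ 4 *ℕ (q *ℕ (E *ℕ R))
        ≤⟨ ℕ.+-mono-≤ (ℕ.≤-reflexive (cong ((4 +ℕ s) *ℕ (4 +ℕ s) *ℕ_) (dominant-power q s)))
                      (ℕ.*-monoʳ-≤ ((4 +ℕ s) *ℕ 4) (b≡0-power q s)) ⟩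
      (4 +ℕ s) *ℕ (4 +ℕ s) *ℕ Q +ℕ (4 +ℕ s) *ℕ 4 *ℕ V
        ≤⟨ lower-order-absorption s Q V 1≤s Q≤V ⟩
      s *ℕ s *ℕ Q +ℕ 44 *ℕ s *ℕ V
        ≡⟨ rearrange (q ^ (4 ∸ℕ s % 2)) (q ^ s) (q ^ 4) s ⟩
      q ^ (4 ∸ℕ s % 2) *ℕ (s *ℕ s) *ℕ q ^ s +ℕ 44 *ℕ q ^ 4 *ℕ s *ℕ q ^ s ∎
      where
      open ℕ.≤-Reasoning
      q = card
      instance
        q≢0 : NonZero q
        q≢0 = >-nonZero (ℕ.≤-trans (s≤s z≤n) 2≤card)
      m = suc ((q ∸ℕ 3) / 2)
      A = s / 4
      E = q ^ suc (s / 2)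
      R = q ^ suc (s / 3)
      Q = q ^ (4 ∸ℕ s % 2) *ℕ q ^ s
      V = q ^ 4 *ℕ q ^ s
      2m≤q : 2 *ℕ m ≤ q
      2m≤q = 2*suc[[q∸3]/2]≤q 2≤card
      4A≤s : 4 *ℕ A ≤ s
      4A≤s = subst (_≤ s) (ℕ.*-comm A 4) (m/n*n≤m s 4)
      Q≤V : Q ≤ V
      Q≤V = ℕ.*-monoˡ-≤ (q ^ s) (ℕ.^-monoʳ-≤ q (ℕ.m∸n≤m 4 (s % 2)))
      rearrange : ∀ x y z s → s *ℕ s *ℕ (x *ℕ y) +ℕ 44 *ℕ s *ℕ (z *ℕ y) ≡ x *ℕ (s *ℕ s) *ℕ y +ℕ 44 *ℕ z *ℕ s *ℕ y
      rearrange = solve-∀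

open import Data.Nat using (_+_; _*_)

lemma7p1 : (K : FiniteField) → (p k : ℕ) → Prime p → 5 ≤ p →
           FiniteField.card K ≡ p ^ k →
           (h : FiniteField.F K) → FieldOps.PrimitiveRoot K h →
           Σ ℕ λ C → Σ ℕ λ s₀ → (s : ℕ) → s₀ ≤ s →
             (xs : List (FieldOps.Form K)) → Unique xs →
             All (FieldOps.InFs K h s) xs →
             ((s % 2 ≡ 1 →
                32 * length xs ≤ FiniteField.card K ^ 3 * (s * s) * FiniteField.card K ^ s
                                 + C * s * FiniteField.card K ^ s)
             × (s % 2 ≡ 0 →
                32 * length xs ≤ FiniteField.card K ^ 4 * (s * s) * FiniteField.card K ^ s
                                 + C * s * FiniteField.card K ^ s))
lemma7p1 K p k p-prime 5≤p q≡p^k h _ = 44 * q ^ 4 , 1 , λ s 1≤s xs u xs∈Fs →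
  let bound = Fs-count-bound K h s 1+1≢0 1≤s xs u xs∈Fs
      at : ∀ {r} → s % 2 ≡ r → 32 * length xs ≤ q ^ (4 ∸ℕ r) * (s * s) * q ^ s + 44 * q ^ 4 * s * q ^ s
      at s%2≡r = subst (λ r → 32 * length xs ≤ q ^ (4 ∸ℕ r) * (s * s) * q ^ s + 44 * q ^ 4 * s * q ^ s) s%2≡r bound
  in at , at
  where
  q = FiniteField.card K
  p≢2 : p ≢ 2
  p≢2 refl = contradiction 5≤p λ { (s≤s (s≤s ())) }
  1+1≢0 : FiniteField._+_ K (FiniteField.1# K) (FiniteField.1# K) ≢ FiniteField.0# K
  1+1≢0 = ¬2∣card⇒1+1≢0 K (subst (λ n → ¬ 2 ∣ n) (sym q≡p^k) (prime≢2⇒¬2∣prime^ p-prime p≢2 k))
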